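{- Let $\mathcal D=(A,U)$ be a decision problem on a product state space $S=X_1\times\cdots\times X_n$ in which each coordinate type $X_i$ has decidable equality, and let $I$ be a minimal sufficient set for $\mathcal D$. Then a coordinate set $J\subseteq\{1,\dots,n\}$ is sufficient for $\mathcal D$ if and only if $I\subseteq J$.
   Context: A decision problem on $S=X_1\times\cdots\times X_n$ consists of an action set $A$ and a utility $U:A\times S\to\mathbb R$, with optimizer map $\mathrm{Opt}(s)=\{a\in A:\ U(a',s)\le U(a,s)\ \forall a'\in A\}$. For $I\subseteq\{1,\dots,n\}$, $I$ is sufficient if whenever $s_j=s'_j$ for all $j\in I$ we have $\mathrm{Opt}(s)=\mathrm{Opt}(s')$; $I$ is minimal sufficient if it is sufficient and no proper subset of $I$ is sufficient. -}

module Defs where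

open import Level using (0ℓ)
open import Data.Nat using (ℕ)
open import Data.Fin using (Fin)
open import Data.Fin.Subset using (Subset; _∈_; _⊂_)
open import Data.Product using (_×_)
open import Relation.Nullary using (¬_)
open import Relation.Unary using (Pred; _≐_)
open import Relation.Binary.Bundles using (TotalOrder)
open import Relation.Binary.PropositionalEquality using (_≡_)

State : {n : ℕ} → (Fin n → Set) → Set
State {n} X = (i : Fin n) → X i

-- A decision problem: action set A and utility U : A × S → V, where V is a
-- totally ordered value type (ℝ in the paper).
record DecisionProblem {n : ℕ} (X : Fin n → Set) (V : TotalOrder 0ℓ 0ℓ 0ℓ) : Set₁ where
  open TotalOrder V using (Carrier; _≤_)
  field
    Action  : Set
    utility : Action → State X → Carrier

  Opt : State X → Pred Action 0ℓ
  Opt s a = (a′ : Action) → utility a′ s ≤ utility a s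

AgreeOn : {n : ℕ} {X : Fin n → Set} → Subset n → State X → State X → Set
AgreeOn I s s′ = ∀ j → j ∈ I → s j ≡ s′ j

module _ {n : ℕ} {X : Fin n → Set} {V : TotalOrder 0ℓ 0ℓ 0ℓ}
         (D : DecisionProblem X V) where
  open DecisionProblem D

  Sufficient : Subset n → Set
  Sufficient I = ∀ (s s′ : State X) → AgreeOn I s s′ → Opt s ≐ Opt s′

  MinimalSufficient : Subset n → Set
  MinimalSufficient I = Sufficient I × (∀ K → K ⊂ I → ¬ Sufficient K)

{-# OPTIONS --safe #-}
-- Sufficiency is upward closed, and it is closed under intersection: if s and s′
-- agree on I ∩ J, the hybrid state that copies s on I and s′ off I agrees with s on I
-- and with s′ on J, so Opt s ≐ Opt (hybrid) ≐ Opt s′. If J is sufficient but I ⊈ J,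
-- then I ∩ J is a sufficient proper subset of I, contradicting minimality.
module Submission where

open import Defs
open import Level using (0ℓ)
open import Data.Nat using (ℕ)
open import Data.Fin using (Fin)
open import Data.Fin.Subset using (Subset; _⊆_; _⊂_; _∩_; _∈_; _∉_)
open import Data.Fin.Subset.Properties using (_∈?_; p∩q⊆p; x∈p∩q⁺; x∈p∩q⁻)
open import Data.Product using (_,_; proj₁; proj₂)
open import Function.Bundles using (_⇔_; mk⇔)
open import Relation.Binary.Bundles using (TotalOrder)
open import Relation.Binary.Definitions using (DecidableEquality)
open import Relation.Binary.PropositionalEquality using (refl)
open import Relation.Nullary using (yes; no; contradiction)
open import Relation.Unary.Properties using (≐-trans)

∩-⊂ˡ : ∀ {n} {p q : Subset n} {x : Fin n} → x ∈ p → x ∉ q → p ∩ q ⊂ p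
∩-⊂ˡ {p = p} {q} {x} x∈p x∉q = p∩q⊆p p q , x , x∈p , λ x∈p∩q → x∉q (proj₂ (x∈p∩q⁻ p q x∈p∩q))

module _ {n : ℕ} {X : Fin n → Set} where

  hybrid : Subset n → State X → State X → State X
  hybrid I s s′ j with j ∈? I
  ... | yes _ = s j
  ... | no  _ = s′ j

  hybrid-agreesˡ : ∀ I (s s′ : State X) → AgreeOn I s (hybrid I s s′)
  hybrid-agreesˡ I s s′ j j∈I with j ∈? I
  ... | yes _   = refl
  ... | no  j∉I = contradiction j∈I j∉I

  hybrid-agreesʳ : ∀ I J (s s′ : State X) → AgreeOn (I ∩ J) s s′ → AgreeOn J (hybrid I s s′) s′
  hybrid-agreesʳ I J s s′ agree j j∈J with j ∈? I
  ... | yes j∈I = agree j (x∈p∩q⁺ (j∈I , j∈J))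
  ... | no  _   = refl

module _ {n : ℕ} {X : Fin n → Set} {V : TotalOrder 0ℓ 0ℓ 0ℓ}
         (D : DecisionProblem X V) where

  sufficient-mono : ∀ {I J} → I ⊆ J → Sufficient D I → Sufficient D J
  sufficient-mono I⊆J suffI s s′ agree = suffI s s′ (λ j j∈I → agree j (I⊆J j∈I))

  sufficient-∩ : ∀ {I J} → Sufficient D I → Sufficient D J → Sufficient D (I ∩ J)
  sufficient-∩ {I} {J} suffI suffJ s s′ agree =
    ≐-trans (suffI s t (hybrid-agreesˡ I s s′)) (suffJ t s′ (hybrid-agreesʳ I J s s′ agree))
    where
      t : State X
      t = hybrid I s s′

  minimalSufficient⇒⊆ : ∀ {I J} → MinimalSufficient D I → Sufficient D J → I ⊆ J
  minimalSufficient⇒⊆ {I} {J} (suffI , minimal) suffJ {x} x∈I with x ∈? J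
  ... | yes x∈J = x∈J
  ... | no  x∉J = contradiction (sufficient-∩ suffI suffJ) (minimal (I ∩ J) (∩-⊂ˡ x∈I x∉J))

-- Membership in a Subset is decidable.
mainTheorem3 : {n : ℕ} {X : Fin n → Set} {V : TotalOrder 0ℓ 0ℓ 0ℓ}
    → (decEq : (i : Fin n) → DecidableEquality (X i))
    → (D : DecisionProblem X V)
    → (I : Subset n) → MinimalSufficient D I
    → (J : Subset n) → (Sufficient D J ⇔ I ⊆ J)
mainTheorem3 _ D _ minimalI _ =
  mk⇔ (minimalSufficient⇒⊆ D minimalI) (λ I⊆J → sufficient-mono D I⊆J (proj₁ minimalI))
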